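{- Let $G$ be a finite bipartite graph with parts $X$ and $Y$, and let $\eta : X \to \mathbb{N}^+$. If $|N_G(X)| \geq \sum_{x \in X} \eta(x)$, then $G$ has a subgraph $H$ such that $d_H(x) = \eta(x)$ for each $x \in X \cap V(H)$, $d_H(y) = 1$ for each $y \in Y \cap V(H)$, and $N_G(Y \cap V(H)) \subseteq V(H)$.
   Context: $N_G(A)$ denotes the set of vertices adjacent in $G$ to some vertex of $A$; $d_H(v)$ is the degree of $v$ in $H$; $\mathbb{N}^+$ is the set of positive integers. -}

module Defs where

open import Data.Nat using (ℕ; zero; suc; _+_)
open import Data.Bool using (Bool; true; false; T)
open import Data.Fin using (Fin)
open import Data.Fin.Properties using (any?)
open import Data.List using (List; length; filter; map)
open import Data.Nat.ListAction using (sum)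
open import Data.List.Base using (allFin)
open import Data.Product using (∃; _×_)
open import Relation.Binary.PropositionalEquality using (_≡_)
open import Relation.Nullary.Decidable using (Dec)
open import Data.Bool.Properties using (T?)

-- A finite bipartite graph with parts X = Fin m and Y = Fin n,
-- given by its (Boolean) biadjacency relation: G x y = true iff xy is an edge.
BipGraph : ℕ → ℕ → Set
BipGraph m n = Fin m → Fin n → Bool

countB : {k : ℕ} → (Fin k → Bool) → ℕ
countB {k} p = length (filter (λ i → T? (p i)) (allFin k))

NXsize : {m n : ℕ} → BipGraph m n → ℕ
NXsize {m} {n} G = length (filter (λ y → any? (λ x → T? (G x y))) (allFin n))

sumOver : {m : ℕ} → (Fin m → ℕ) → ℕ
sumOver {m} η = sum (map η (allFin m))

record Subgraph {m n : ℕ} (G : BipGraph m n) : Set where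
  field
    VX : Fin m → Bool
    VY : Fin n → Bool
    EH : Fin m → Fin n → Bool
    EH⊆G  : ∀ x y → EH x y ≡ true → G x y ≡ true
    EH-VX : ∀ x y → EH x y ≡ true → VX x ≡ true
    EH-VY : ∀ x y → EH x y ≡ true → VY y ≡ true

degX : {m n : ℕ} {G : BipGraph m n} → Subgraph G → Fin m → ℕ
degX H x = countB (λ y → Subgraph.EH H x y)

degY : {m n : ℕ} {G : BipGraph m n} → Subgraph G → Fin n → ℕ
degY H y = countB (λ x → Subgraph.EH H x y)

-- Call s ⊆ X feasible if Σ_{x ∈ s} η(x) ≤ |Y_s|, where Y_s (enclosed G s) is the set of
-- vertices of Y that have a neighbour and all of whose neighbours lie in s; X is feasible,
-- since Y_X = N_G(X). Take a nonempty feasible s of minimum size. For T ⊆ X, every vertex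
-- of Y_s without a neighbour in T lies in Y_r for r = s ∖ T, and |Y_r| ≤ Σ_{x ∈ r} η(x) by
-- minimality; hence Hall's condition holds for the demands η on s in the graph between s
-- and Y_s. Hall's theorem with demands (induction on Σ η: split along a critical set, or
-- else remove one edge) gives a subgraph H in which each x ∈ s has η(x) private
-- neighbours in Y_s; as these have all their neighbours in s, H is closed.
module Submission where

open import Defs
open import Data.Nat using (ℕ; _≤_; _≥_)
open import Data.Bool using (Bool; true)
open import Data.Fin using (Fin)
open import Data.Product using (Σ; ∃; _×_)
open import Relation.Binary.PropositionalEquality using (_≡_)

open import Data.Bool using (false; not; _∧_; _∨_; if_then_else_)
open import Data.Bool.Properties using (∧-conicalˡ; ∧-conicalʳ; ∨-zeroʳ; T-≡)
open import Data.Empty using (⊥; ⊥-elim)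
open import Data.Fin using (zero; suc)
open import Data.Fin.Properties using (any?; _≟_)
open import Data.Fin.Subset.Properties using (anySubset?)
import Data.List as List
open import Data.List using (length; filter)
open import Data.List.Properties using (map-tabulate)
open import Data.Nat using (zero; suc; _+_; _∸_; _<_; z≤n; s≤s; s≤s⁻¹; z<s; _<?_; _≤?_)
import Data.Nat.ListAction as ℕᴸ
open import Data.Nat.Induction using (<-wellFounded)
open import Data.Nat.Properties hiding (_≟_)
open import Algebra.Properties.CommutativeMonoid.Sum +-0-commutativeMonoid
  using (sum; sum-cong-≗; ∑-distrib-+; sum-replicate-zero)
open import Data.Product using (_,_)
open import Data.Sum using (_⊎_; inj₁; inj₂; [_,_]′)
open import Data.Vec using (lookup; tabulate)
open import Data.Vec.Properties using (lookup∘tabulate)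
open import Function using (_∘_; id)
open import Function.Bundles using (Equivalence)
open import Induction.WellFounded using (Acc; acc)
open import Relation.Binary.Definitions using (_Respects_)
open import Relation.Binary.PropositionalEquality
  using (refl; sym; trans; cong; cong₂; subst; subst₂; _≗_)
open import Relation.Nullary using (¬_; Dec; yes; no; does)
open import Relation.Nullary.Decidable using (map′; T?; dec-true; _×-dec_)
open import Relation.Unary using (Pred; Decidable)

private
  variable
    k : ℕ
    i j : Fin k
    w v : Fin k → ℕ
    S T U : Fin k → Bool

sum-mono-≤ : ∀ {f g : Fin k → ℕ} → (∀ i → f i ≤ g i) → sum f ≤ sum g
sum-mono-≤ {zero}  f≤g = z≤n
sum-mono-≤ {suc k} f≤g = +-mono-≤ (f≤g zero) (sum-mono-≤ (f≤g ∘ suc))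

sum-mono-< : ∀ {f g : Fin k → ℕ} → (∀ i → f i ≤ g i) → ∀ i → f i < g i → sum f < sum g
sum-mono-< f≤g zero    f<g = +-mono-<-≤ f<g (sum-mono-≤ (f≤g ∘ suc))
sum-mono-< f≤g (suc i) f<g = +-mono-≤-< (f≤g zero) (sum-mono-< (f≤g ∘ suc) i f<g)

≤-sum : ∀ (f : Fin k → ℕ) i → f i ≤ sum f
≤-sum f zero    = m≤m+n _ _
≤-sum f (suc i) = ≤-trans (≤-sum (f ∘ suc) i) (m≤n+m _ (f zero))

positive-summand : ∀ (f : Fin k → ℕ) → 0 < sum f → ∃ λ i → 0 < f i
positive-summand {suc k} f 0<sum with f zero in eq
... | suc _ = zero , ≤-trans (s≤s z≤n) (≤-reflexive (sym eq))
... | zero  = let i , 0<fi = positive-summand (f ∘ suc) 0<sum in suc i , 0<fi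

sum-tabulate : ∀ (f : Fin k → ℕ) → ℕᴸ.sum (List.tabulate f) ≡ sum f
sum-tabulate {zero}  f = refl
sum-tabulate {suc k} f = cong (f zero +_) (sum-tabulate (f ∘ suc))

sumOver≡sum : ∀ (w : Fin k → ℕ) → sumOver w ≡ sum w
sumOver≡sum w = trans (cong ℕᴸ.sum (map-tabulate id w)) (sum-tabulate w)

true-or-not : ∀ b → b ≡ true ⊎ not b ≡ true
true-or-not true  = inj₁ refl
true-or-not false = inj₂ refl

not-both : ∀ {b} → not b ≡ true → b ≡ true → ⊥
not-both {true} ()

∨-introˡ : ∀ {a b} → a ≡ true → a ∨ b ≡ true
∨-introˡ refl = refl

∨-introʳ : ∀ {a b} → b ≡ true → a ∨ b ≡ true
∨-introʳ {a} refl = ∨-zeroʳ a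

∨-elim : ∀ {a b} → a ∨ b ≡ true → a ≡ true ⊎ b ≡ true
∨-elim {true}  _ = inj₁ refl
∨-elim {false} e = inj₂ e

∅ ⊤ : Fin k → Bool
∅ _ = false
⊤ _ = true

∁ : (Fin k → Bool) → Fin k → Bool
∁ S i = not (S i)

infixr 6 _∪_
infixr 7 _∩_
infix 4 _⊆_

_∪_ _∩_ : (Fin k → Bool) → (Fin k → Bool) → Fin k → Bool
(S ∪ T) i = S i ∨ T i
(S ∩ T) i = S i ∧ T i

_⊆_ : (Fin k → Bool) → (Fin k → Bool) → Set
S ⊆ T = ∀ i → S i ≡ true → T i ≡ true

Disjoint : (Fin k → Bool) → (Fin k → Bool) → Set
Disjoint S T = ∀ i → S i ≡ true → T i ≡ true → ⊥

⁅_⁆ : Fin k → Fin k → Bool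
⁅ i ⁆ j = does (j ≟ i)

⁅⁆-self : ∀ (i : Fin k) → ⁅ i ⁆ i ≡ true
⁅⁆-self zero    = refl
⁅⁆-self (suc i) = ⁅⁆-self i

⁅⁆-sound : ⁅ i ⁆ j ≡ true → j ≡ i
⁅⁆-sound {i = i} {j} e with j ≟ i
... | yes j≡i = j≡i

_↾_ : (Fin k → ℕ) → (Fin k → Bool) → Fin k → ℕ
(w ↾ S) i = if S i then w i else 0

↾-+-↾∁ : ∀ (w : Fin k → ℕ) S i → (w ↾ S) i + (w ↾ ∁ S) i ≡ w i
↾-+-↾∁ w S i with S i
... | true  = +-identityʳ (w i)
... | false = refl

δ : Fin k → Fin k → ℕ
δ i = (λ _ → 1) ↾ ⁅ i ⁆

∸-δ-≤ : ∀ j → w j ∸ δ i j ≤ w j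
∸-δ-≤ {w = w} {i = i} j = m∸n≤m (w j) (δ i j)

∸-δ-< : 0 < w i → w i ∸ δ i i < w i
∸-δ-< {w = w} {i = i} 0<wi =
  subst (λ b → w i ∸ (if b then 1 else 0) < w i) (sym (⁅⁆-self i)) (∸-monoʳ-< z<s 0<wi)

δ-+-∸-δ : 0 < w i → ∀ j → δ i j + (w j ∸ δ i j) ≡ w j
δ-+-∸-δ {w = w} {i = i} 0<wi j = m+[n∸m]≡n δ≤w
  where
  δ≤w : δ i j ≤ w j
  δ≤w with ⁅ i ⁆ j in j≡i
  ... | true  = subst (λ x → 0 < w x) (sym (⁅⁆-sound j≡i)) 0<wi
  ... | false = z≤n

-- Opaque so that implicit sets and weights are recovered by unification
-- rather than lost in the unfolding of the sum.
opaque
  weight : (Fin k → ℕ) → (Fin k → Bool) → ℕ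
  weight w S = sum (w ↾ S)

  weight≡sum : weight w S ≡ sum (w ↾ S)
  weight≡sum = refl

  weight-cong : S ≗ T → weight w S ≡ weight w T
  weight-cong {w = w} S≗T = sum-cong-≗ λ i → cong (λ b → if b then w i else 0) (S≗T i)

  weight-∅ : weight w (∅ {k}) ≡ 0
  weight-∅ {k} = sum-replicate-zero k

  weight-⁅⁆ : ∀ (w : Fin k → ℕ) i → weight w ⁅ i ⁆ ≡ w i
  weight-⁅⁆ {suc k} w zero    = trans (cong (w zero +_) (weight-∅ {w = w ∘ suc})) (+-identityʳ (w zero))
  weight-⁅⁆ {suc k} w (suc i) = weight-⁅⁆ (w ∘ suc) i

  ≤-weight : S i ≡ true → w i ≤ weight w S
  ≤-weight {S = S} {i = i} {w = w} Si =
    subst (λ b → (if b then w i else 0) ≤ weight w S) Si (≤-sum (w ↾ S) i)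

  weight-positive : 0 < weight w S → ∃ λ i → S i ≡ true × 0 < w i
  weight-positive {w = w} {S = S} 0<weight with positive-summand (w ↾ S) 0<weight
  ... | i , 0<wSi with S i in Si
  ...   | true = i , Si , 0<wSi

  weight-mono : S ⊆ T → weight w S ≤ weight w T
  weight-mono {S = S} {T} {w = w} S⊆T = sum-mono-≤ pointwise
    where
    pointwise : ∀ i → (w ↾ S) i ≤ (w ↾ T) i
    pointwise i with S i in Si
    ... | false = z≤n
    ... | true rewrite S⊆T i Si = ≤-refl

  weight-∪ : S ⊆ T ∪ U → weight w S ≤ weight w T + weight w U
  weight-∪ {S = S} {T} {U} {w = w} S⊆T∪U =
    ≤-trans (sum-mono-≤ pointwise) (≤-reflexive (∑-distrib-+ (w ↾ T) (w ↾ U)))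
    where
    pointwise : ∀ i → (w ↾ S) i ≤ (w ↾ T) i + (w ↾ U) i
    pointwise i with S i in Si
    ... | false = z≤n
    ... | true with T i | U i | S⊆T∪U i Si
    ...   | true  | _    | _ = m≤m+n _ _
    ...   | false | true | _ = ≤-refl

  weight-∪-disjoint : Disjoint S T → weight w (S ∪ T) ≡ weight w S + weight w T
  weight-∪-disjoint {S = S} {T} {w = w} S#T =
    trans (sum-cong-≗ pointwise) (∑-distrib-+ (w ↾ S) (w ↾ T))
    where
    pointwise : ∀ i → (w ↾ (S ∪ T)) i ≡ (w ↾ S) i + (w ↾ T) i
    pointwise i with S i in Si | T i in Ti
    ... | true  | true  = ⊥-elim (S#T i Si Ti)
    ... | true  | false = sym (+-identityʳ (w i))
    ... | false | _     = refl

  weight-↾ : ∀ (w : Fin k → ℕ) S T → weight (w ↾ S) T ≡ weight w (S ∩ T)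
  weight-↾ w S T = sum-cong-≗ pointwise
    where
    pointwise : ∀ i → ((w ↾ S) ↾ T) i ≡ (w ↾ (S ∩ T)) i
    pointwise i with S i | T i
    ... | true  | _     = refl
    ... | false | true  = refl
    ... | false | false = refl

  weight-monoʷ : (∀ i → v i ≤ w i) → weight v S ≤ weight w S
  weight-monoʷ {v = v} {w = w} {S = S} v≤w = sum-mono-≤ pointwise
    where
    pointwise : ∀ i → (v ↾ S) i ≤ (w ↾ S) i
    pointwise i with S i
    ... | true  = v≤w i
    ... | false = z≤n

  weight-monoʷ-< : (∀ i → v i ≤ w i) → S i ≡ true → v i < w i → weight v S < weight w S
  weight-monoʷ-< {v = v} {w = w} {S = S} {i = i} v≤w Si vi<wi =
    sum-mono-< pointwise i
      (subst (λ b → (if b then v i else 0) < (if b then w i else 0)) (sym Si) vi<wi)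
    where
    pointwise : ∀ i → (v ↾ S) i ≤ (w ↾ S) i
    pointwise i with S i
    ... | true  = v≤w i
    ... | false = z≤n

weight-split : ∀ (w : Fin k → ℕ) S T → weight w S ≡ weight w (S ∩ T) + weight w (S ∩ ∁ T)
weight-split w S T = trans (weight-cong pieces) (weight-∪-disjoint disjoint)
  where
  pieces : S ≗ S ∩ T ∪ S ∩ ∁ T
  pieces i with S i | T i
  ... | true  | true  = refl
  ... | true  | false = refl
  ... | false | _     = refl
  disjoint : Disjoint (S ∩ T) (S ∩ ∁ T)
  disjoint i with S i | T i
  ... | true  | true  = λ _ ()
  ... | true  | false = λ ()
  ... | false | _     = λ ()

sum-↾-< : 0 < weight w (∁ S) → sum (w ↾ S) < sum w
sum-↾-< {w = w} {S = S} 0<w∁S =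
  subst₂ _<_ weight≡sum (trans (sym (weight-split w ⊤ S)) weight≡sum) (m<m+n (weight w S) 0<w∁S)

sum-↾∁-< : 0 < weight w S → sum (w ↾ ∁ S) < sum w
sum-↾∁-< {w = w} {S = S} 0<wS =
  subst₂ _<_ weight≡sum (trans (sym (weight-split w ⊤ S)) weight≡sum) (m<n+m (weight w (∁ S)) 0<wS)

count : (Fin k → Bool) → ℕ
count = weight (λ _ → 1)

count-∅ : count (∅ {k}) ≡ 0
count-∅ = weight-∅

count-⁅⁆ : ∀ (i : Fin k) → count ⁅ i ⁆ ≡ 1
count-⁅⁆ = weight-⁅⁆ (λ _ → 1)

count-positive : 0 < count S → ∃ λ i → S i ≡ true
count-positive 0<count = let i , Si , _ = weight-positive 0<count in i , Si

∈⇒count-positive : S i ≡ true → 0 < count S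
∈⇒count-positive = ≤-weight

opaque
  unfolding weight

  length-filter-tabulate : ∀ {a p} {A : Set a} {P : Pred A p} (P? : Decidable P) (f : Fin k → A) →
                           length (filter P? (List.tabulate f)) ≡ count (λ i → does (P? (f i)))
  length-filter-tabulate {zero}  P? f = refl
  length-filter-tabulate {suc k} P? f with does (P? (f zero))
  ... | true  = cong suc (length-filter-tabulate P? (f ∘ suc))
  ... | false = length-filter-tabulate P? (f ∘ suc)

countB≡count : ∀ (S : Fin k → Bool) → countB S ≡ count S
countB≡count S = length-filter-tabulate (T? ∘ S) id

anyᵇ : (Fin k → Bool) → Bool
anyᵇ p = does (any? (T? ∘ p))

any-intro : ∀ (p : Fin k → Bool) i → p i ≡ true → anyᵇ p ≡ true
any-intro p i pi = dec-true (any? (T? ∘ p)) (i , Equivalence.from T-≡ pi)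

any-elim : ∀ (p : Fin k → Bool) → anyᵇ p ≡ true → ∃ λ i → p i ≡ true
any-elim {suc k} p e with p zero in p0
... | true  = zero , p0
... | false = let i , pi = any-elim (p ∘ suc) e in suc i , pi

any-cong : ∀ {p q : Fin k → Bool} → p ≗ q → anyᵇ p ≡ anyᵇ q
any-cong {zero}  p≗q = refl
any-cong {suc k} p≗q = cong₂ _∨_ (p≗q zero) (any-cong (p≗q ∘ suc))

any-subset? : ∀ {ℓ} {P : Pred (Fin k → Bool) ℓ} → P Respects _≗_ → Decidable P → Dec (∃ P)
any-subset? resp P? =
  map′ (λ (S , PS) → lookup S , PS)
       (λ (S , PS) → tabulate S , resp (sym ∘ lookup∘tabulate S) PS)
       (anySubset? (P? ∘ lookup))

module _ {a ℓ} {A : Set a} {P : Pred A ℓ} (μ : A → ℕ)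
         (smaller? : ∀ x → Dec (∃ λ y → P y × μ y < μ x)) where

  minimum : ∀ {x} → P x → ∃ λ y → P y × (∀ z → P z → μ y ≤ μ z)
  minimum {x} = go x (<-wellFounded (μ x))
    where
    go : ∀ x → Acc _<_ (μ x) → P x → ∃ λ y → P y × (∀ z → P z → μ y ≤ μ z)
    go x (acc rec) Px with smaller? x
    ... | yes (y , Py , y<x) = go y (rec y<x) Py
    ... | no  ∄y             = x , Px , λ z Pz → ≮⇒≥ (λ z<x → ∄y (z , Pz , z<x))

least-subset : ∀ {ℓ} {P : Pred (Fin k → Bool) ℓ} → P Respects _≗_ → Decidable P →
               P S → ∃ λ T → P T × (∀ U → P U → count T ≤ count U)
least-subset {P = P} resp P? = minimum count smaller?
  where
  smaller? : ∀ S → Dec (∃ λ T → P T × count T < count S)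
  smaller? S =
    any-subset? (λ T≗U (PT , T<S) → resp T≗U PT , subst (_< count S) (weight-cong T≗U) T<S)
                (λ T → P? T ×-dec count T <? count S)

module _ {m n : ℕ} where

  private
    variable
      G : BipGraph m n
      η : Fin m → ℕ
      x x₀ : Fin m
      y y₀ : Fin n

  opaque
    N : BipGraph m n → (Fin m → Bool) → Fin n → Bool
    N G S y = anyᵇ (λ x → S x ∧ G x y)

    N-intro : S x ≡ true → G x y ≡ true → N G S y ≡ true
    N-intro {S = S} {x = x} {G = G} {y = y} Sx Gxy =
      any-intro (λ x → S x ∧ G x y) x (cong₂ _∧_ Sx Gxy)

    N-elim : N G S y ≡ true → ∃ λ x → S x ≡ true × G x y ≡ true
    N-elim e = let x , SGx = any-elim _ e in x , ∧-conicalˡ _ _ SGx , ∧-conicalʳ _ _ SGx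

    N-cong : S ≗ T → N G S ≗ N G T
    N-cong S≗T y = any-cong (λ x → cong (_∧ _) (S≗T x))

    NXsize≡count : ∀ (G : BipGraph m n) → NXsize G ≡ count (N G ⊤)
    NXsize≡count G = length-filter-tabulate (λ y → any? (λ x → T? (G x y))) id

  _↾ʸ_ : BipGraph m n → (Fin n → Bool) → BipGraph m n
  (G ↾ʸ B) x y = G x y ∧ B y

  HallCondition : BipGraph m n → (Fin m → ℕ) → Set
  HallCondition G η = ∀ S → weight η S ≤ count (N G S)

  record Matching (G : BipGraph m n) (η : Fin m → ℕ) : Set where
    field
      E    : BipGraph m n
      E⊆G  : ∀ x y → E x y ≡ true → G x y ≡ true
      degˣ : ∀ x → count (E x) ≡ η x
      degʸ : ∀ y → count (λ x → E x y) ≤ 1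

  matching-cong : ∀ {η η′ : Fin m → ℕ} → η ≗ η′ → Matching G η → Matching G η′
  matching-cong η≗η′ M = record
    { E = E ; E⊆G = E⊆G ; degˣ = λ x → trans (degˣ x) (η≗η′ x) ; degʸ = degʸ }
    where open Matching M

  empty-matching : sum η ≡ 0 → Matching G η
  empty-matching {η = η} Ση≡0 = record
    { E    = λ _ _ → false
    ; E⊆G  = λ _ _ ()
    ; degˣ = λ x → trans count-∅ (sym (n≤0⇒n≡0 (subst (η x ≤_) Ση≡0 (≤-sum η x))))
    ; degʸ = λ _ → ≤-trans (≤-reflexive count-∅) z≤n
    }

  single-edge : G x₀ y₀ ≡ true → Matching G (δ x₀)
  single-edge {G = G} {x₀ = x₀} {y₀ = y₀} Gx₀y₀ = record
    { E    = λ x y → ⁅ x₀ ⁆ x ∧ ⁅ y₀ ⁆ y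
    ; E⊆G  = λ x y e → subst₂ (λ x y → G x y ≡ true)
                         (sym (⁅⁆-sound (∧-conicalˡ _ _ e))) (sym (⁅⁆-sound (∧-conicalʳ _ _ e))) Gx₀y₀
    ; degˣ = degˣ
    ; degʸ = λ y → ≤-trans (weight-mono (column⊆⁅x₀⁆ y)) (≤-reflexive (count-⁅⁆ x₀))
    }
    where
    column⊆⁅x₀⁆ : ∀ y → (λ x → ⁅ x₀ ⁆ x ∧ ⁅ y₀ ⁆ y) ⊆ ⁅ x₀ ⁆
    column⊆⁅x₀⁆ y x = ∧-conicalˡ _ _
    degˣ : ∀ x → count (λ y → ⁅ x₀ ⁆ x ∧ ⁅ y₀ ⁆ y) ≡ δ x₀ x
    degˣ x with ⁅ x₀ ⁆ x
    ... | true  = count-⁅⁆ y₀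
    ... | false = count-∅

  matching-∪ : ∀ {B} {η₁ η₂ : Fin m → ℕ} → Matching (G ↾ʸ B) η₁ → Matching (G ↾ʸ ∁ B) η₂ →
            Matching G (λ x → η₁ x + η₂ x)
  matching-∪ {G = G} {B = B} M₁ M₂ = record
    { E    = λ x → M₁.E x ∪ M₂.E x
    ; E⊆G  = λ x y e → [ (λ e₁ → ∧-conicalˡ _ _ (M₁.E⊆G x y e₁))
                       , (λ e₂ → ∧-conicalˡ _ _ (M₂.E⊆G x y e₂)) ]′ (∨-elim e)
    ; degˣ = λ x → trans (weight-∪-disjoint (λ y e₁ e₂ → not-both (∈∁B {x} {y} e₂) (∈B {x} {y} e₁)))
                         (cong₂ _+_ (M₁.degˣ x) (M₂.degˣ x))
    ; degʸ = degʸ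
    }
    where
    module M₁ = Matching M₁
    module M₂ = Matching M₂
    ∈B : M₁.E x y ≡ true → B y ≡ true
    ∈B e = ∧-conicalʳ _ _ (M₁.E⊆G _ _ e)
    ∈∁B : M₂.E x y ≡ true → ∁ B y ≡ true
    ∈∁B e = ∧-conicalʳ _ _ (M₂.E⊆G _ _ e)
    degʸ : ∀ y → count (λ x → (M₁.E x ∪ M₂.E x) y) ≤ 1
    degʸ y with true-or-not (B y)
    ... | inj₁ By  = ≤-trans (weight-mono only₁) (M₁.degʸ y)
      where
      only₁ : (λ x → (M₁.E x ∪ M₂.E x) y) ⊆ (λ x → M₁.E x y)
      only₁ x e = [ id , (λ e₂ → ⊥-elim (not-both (∈∁B e₂) By)) ]′ (∨-elim e)
    ... | inj₂ ∁By = ≤-trans (weight-mono only₂) (M₂.degʸ y)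
      where
      only₂ : (λ x → (M₁.E x ∪ M₂.E x) y) ⊆ (λ x → M₂.E x y)
      only₂ x e = [ (λ e₁ → ⊥-elim (not-both ∁By (∈B e₁))) , id ]′ (∨-elim e)

  Critical : BipGraph m n → (Fin m → ℕ) → (Fin m → Bool) → Set
  Critical G η S = 0 < weight η S × 0 < weight η (∁ S) × count (N G S) ≤ weight η S

  critical? : ∀ G η → Decidable (Critical G η)
  critical? G η S = 0 <? weight η S ×-dec 0 <? weight η (∁ S) ×-dec count (N G S) ≤? weight η S

  critical-resp : (Critical G η) Respects _≗_
  critical-resp S≗T (0<ηS , 0<η∁S , tight) =
    subst (0 <_) (weight-cong S≗T) 0<ηS ,
    subst (0 <_) (weight-cong (cong not ∘ S≗T)) 0<η∁S ,
    subst₂ _≤_ (weight-cong (N-cong S≗T)) (weight-cong S≗T) tight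

  hall-inside : ∀ {S} → HallCondition G η → HallCondition (G ↾ʸ N G S) (η ↾ S)
  hall-inside {G = G} {η = η} {S = S} hc T = begin
    weight (η ↾ S) T          ≡⟨ weight-↾ η S T ⟩
    weight η (S ∩ T)          ≤⟨ hc (S ∩ T) ⟩
    count (N G (S ∩ T))       ≤⟨ weight-mono reach ⟩
    count (N (G ↾ʸ N G S) T)  ∎
    where
    open ≤-Reasoning
    reach : N G (S ∩ T) ⊆ N (G ↾ʸ N G S) T
    reach y e = let x , STx , Gxy = N-elim e in
      N-intro (∧-conicalʳ _ _ STx) (cong₂ _∧_ Gxy (N-intro (∧-conicalˡ _ _ STx) Gxy))

  hall-outside : ∀ {S} → HallCondition G η → count (N G S) ≤ weight η S →
                 HallCondition (G ↾ʸ ∁ (N G S)) (η ↾ ∁ S)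
  hall-outside {G = G} {η = η} {S = S} hc tight T = +-cancelʳ-≤ (weight η S) _ _ (begin
    weight (η ↾ ∁ S) T + weight η S   ≡⟨ cong (_+ weight η S) (weight-↾ η (∁ S) T) ⟩
    weight η (∁ S ∩ T) + weight η S   ≡⟨ weight-∪-disjoint disjoint ⟨
    weight η (∁ S ∩ T ∪ S)            ≤⟨ hc (∁ S ∩ T ∪ S) ⟩
    count (N G (∁ S ∩ T ∪ S))         ≤⟨ weight-∪ cover ⟩
    count (N G′ T) + count (N G S)    ≤⟨ +-monoʳ-≤ (count (N G′ T)) tight ⟩
    count (N G′ T) + weight η S       ∎)
    where
    open ≤-Reasoning
    G′ = G ↾ʸ ∁ (N G S)
    disjoint : Disjoint (∁ S ∩ T) S
    disjoint x ∁S∩Tx = not-both (∧-conicalˡ _ _ ∁S∩Tx)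
    cover : N G (∁ S ∩ T ∪ S) ⊆ N G′ T ∪ N G S
    cover y e with true-or-not (N G S y)
    ... | inj₁ NSy  = ∨-introʳ NSy
    ... | inj₂ ∁NSy = let x , x∈ , Gxy = N-elim e in
      ∨-introˡ (N-intro (outside x∈ Gxy) (cong₂ _∧_ Gxy ∁NSy))
      where
      outside : ∀ {x} → (∁ S ∩ T ∪ S) x ≡ true → G x y ≡ true → T x ≡ true
      outside x∈ Gxy =
        [ ∧-conicalʳ _ _ , (λ Sx → ⊥-elim (not-both ∁NSy (N-intro Sx Gxy))) ]′ (∨-elim x∈)

  hall-minus-edge : HallCondition G η → (∀ S → ¬ Critical G η S) → 0 < η x₀ →
                    HallCondition (G ↾ʸ ∁ ⁅ y₀ ⁆) (λ x → η x ∸ δ x₀ x)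
  hall-minus-edge {G = G} {η = η} {x₀ = x₀} {y₀ = y₀} hc ¬critical 0<ηx₀ T
    with 0 <? weight (λ x → η x ∸ δ x₀ x) T
  ... | no  η′T≯0 = ≤-trans (≮⇒≥ η′T≯0) z≤n
  ... | yes 0<η′T = s≤s⁻¹ (begin-strict
    weight η′ T                     <⟨ η′T<NT ⟩
    count (N G T)                   ≤⟨ weight-∪ cover ⟩
    count ⁅ y₀ ⁆ + count (N G′ T)   ≡⟨ cong (_+ count (N G′ T)) (count-⁅⁆ y₀) ⟩
    suc (count (N G′ T))            ∎)
    where
    open ≤-Reasoning
    η′ = λ x → η x ∸ δ x₀ x
    G′ = G ↾ʸ ∁ ⁅ y₀ ⁆
    cover : N G T ⊆ ⁅ y₀ ⁆ ∪ N G′ T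
    cover y e with true-or-not (⁅ y₀ ⁆ y)
    ... | inj₁ y≡y₀ = ∨-introˡ y≡y₀
    ... | inj₂ y≢y₀ = let x , Tx , Gxy = N-elim e in
      ∨-introʳ (N-intro Tx (cong₂ _∧_ Gxy y≢y₀))
    η′T<NT : weight η′ T < count (N G T)
    η′T<NT with true-or-not (T x₀)
    ... | inj₁ Tx₀  = <-≤-trans (weight-monoʷ-< ∸-δ-≤ Tx₀ (∸-δ-< {w = η} 0<ηx₀)) (hc T)
    ... | inj₂ ∁Tx₀ =
      ≤-<-trans (weight-monoʷ ∸-δ-≤) (≰⇒> λ tight → ¬critical T (0<ηT , 0<η∁T , tight))
      where
      0<ηT  = <-≤-trans 0<η′T (weight-monoʷ ∸-δ-≤)
      0<η∁T = ≤-trans 0<ηx₀ (≤-weight ∁Tx₀)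

  edge-exists : HallCondition G η → 0 < η x₀ → ∃ λ y₀ → G x₀ y₀ ≡ true
  edge-exists {G = G} {η = η} {x₀ = x₀} hc 0<ηx₀ =
    let y₀ , y₀∈N = count-positive (≤-trans 0<ηx₀ (≤-trans (≤-weight (⁅⁆-self x₀)) (hc ⁅ x₀ ⁆)))
        x , x≡x₀ , Gxy₀ = N-elim y₀∈N
    in y₀ , subst (λ x → G x y₀ ≡ true) (⁅⁆-sound x≡x₀) Gxy₀

  hall : HallCondition G η → Matching G η
  hall {G = G} {η = η} = go G η (<-wellFounded (sum η))
    where
    go : ∀ G η → Acc _<_ (sum η) → HallCondition G η → Matching G η
    go G η (acc smaller) hc with 0 <? sum η
    ... | no  Ση≯0 = empty-matching (n≤0⇒n≡0 (≮⇒≥ Ση≯0))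
    ... | yes 0<Ση with any-subset? critical-resp (critical? G η)
    ...   | yes (S , 0<ηS , 0<η∁S , tight) =
      matching-cong (↾-+-↾∁ η S)
        (matching-∪ (go _ _ (smaller (sum-↾-< 0<η∁S)) (hall-inside hc))
                    (go _ _ (smaller (sum-↾∁-< 0<ηS)) (hall-outside hc tight)))
    ...   | no ¬critical =
      let x₀ , 0<ηx₀ = positive-summand η 0<Ση
          y₀ , Gx₀y₀ = edge-exists hc 0<ηx₀
      in matching-cong (δ-+-∸-δ 0<ηx₀)
           (matching-∪ (single-edge (cong₂ _∧_ Gx₀y₀ (⁅⁆-self y₀)))
                       (go _ _ (smaller (sum-mono-< ∸-δ-≤ x₀ (∸-δ-< {w = η} 0<ηx₀)))
                           (hall-minus-edge hc (λ S c → ¬critical (S , c)) 0<ηx₀)))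

  opaque
    enclosed : BipGraph m n → (Fin m → Bool) → Fin n → Bool
    enclosed G S y = N G ⊤ y ∧ not (N G (∁ S) y)

    enclosed-⊆ : enclosed G S y ≡ true → G x y ≡ true → S x ≡ true
    enclosed-⊆ {S = S} {x = x} e Gxy with true-or-not (S x)
    ... | inj₁ Sx  = Sx
    ... | inj₂ ∁Sx = ⊥-elim (not-both (∧-conicalʳ _ _ e) (N-intro ∁Sx Gxy))

    enclosed-intro : N G ⊤ y ≡ true → (∀ x → G x y ≡ true → S x ≡ true) →
                     enclosed G S y ≡ true
    enclosed-intro {G = G} {y = y} {S = S} N⊤y nbrs⊆S = cong₂ _∧_ N⊤y no-nbr-outside
      where
      no-nbr-outside : not (N G (∁ S) y) ≡ true
      no-nbr-outside with true-or-not (N G (∁ S) y)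
      ... | inj₂ ∉N∁S = ∉N∁S
      ... | inj₁ ∈N∁S = let x , ∁Sx , Gxy = N-elim ∈N∁S in
        ⊥-elim (not-both ∁Sx (nbrs⊆S x Gxy))

    enclosed⊆N⊤ : enclosed G S ⊆ N G ⊤
    enclosed⊆N⊤ y = ∧-conicalˡ _ _

    enclosed-cong : S ≗ T → enclosed G S ≗ enclosed G T
    enclosed-cong {G = G} S≗T y = cong (λ b → N G ⊤ y ∧ not b) (N-cong (cong not ∘ S≗T) y)

  enclosed-occupied : enclosed G S y ≡ true → ∃ λ x → S x ≡ true
  enclosed-occupied {y = y} e = let x , _ , Gxy = N-elim (enclosed⊆N⊤ y e) in x , enclosed-⊆ e Gxy

  Feasible : BipGraph m n → (Fin m → ℕ) → (Fin m → Bool) → Set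
  Feasible G η S = weight η S ≤ count (enclosed G S)

  feasible? : ∀ G η → Decidable (Feasible G η)
  feasible? G η S = weight η S ≤? count (enclosed G S)

  feasible-resp : (Feasible G η) Respects _≗_
  feasible-resp S≗T = subst₂ _≤_ (weight-cong S≗T) (weight-cong (enclosed-cong S≗T))

  ⊤-feasible : NXsize G ≥ sumOver η → Feasible G η ⊤
  ⊤-feasible {G = G} {η = η} N≥Ση = begin
    weight η ⊤             ≡⟨ weight≡sum ⟩
    sum η                  ≡⟨ sumOver≡sum η ⟨
    sumOver η              ≤⟨ N≥Ση ⟩
    NXsize G               ≡⟨ NXsize≡count G ⟩
    count (N G ⊤)          ≤⟨ weight-mono (λ y N⊤y → enclosed-intro N⊤y (λ _ _ → refl)) ⟩
    count (enclosed G ⊤)   ∎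
    where open ≤-Reasoning

  hall-in-minimal : ∀ {s} → Feasible G η s →
                    (∀ r → Feasible G η r × 0 < count r → count s ≤ count r) →
                    HallCondition (G ↾ʸ enclosed G s) (η ↾ s)
  hall-in-minimal {G = G} {η = η} {s = s} feasible minimal T = begin
    weight (η ↾ s) T   ≡⟨ weight-↾ η s T ⟩
    weight η (s ∩ T)   ≤⟨ bound ⟩
    count (N G′ T)     ∎
    where
    open ≤-Reasoning
    G′ = G ↾ʸ enclosed G s
    r = s ∩ ∁ T
    cover : enclosed G s ⊆ N G′ T ∪ enclosed G r
    cover y e with true-or-not (N G′ T y)
    ... | inj₁ ∈N = ∨-introˡ ∈N
    ... | inj₂ ∉N = ∨-introʳ (enclosed-intro (enclosed⊆N⊤ y e)
                                             λ x Gxy → cong₂ _∧_ (enclosed-⊆ e Gxy) (∉T x Gxy))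
      where
      ∉T : ∀ x → G x y ≡ true → not (T x) ≡ true
      ∉T x Gxy with true-or-not (T x)
      ... | inj₁ Tx  = ⊥-elim (not-both ∉N (N-intro Tx (cong₂ _∧_ Gxy e)))
      ... | inj₂ ∁Tx = ∁Tx
    r-deficient : 0 < count (s ∩ T) → count (enclosed G r) ≤ weight η r
    r-deficient 0<|s∩T| with 0 <? count (enclosed G r)
    ... | no  enc≯0 = ≤-trans (≮⇒≥ enc≯0) z≤n
    ... | yes 0<enc = ≮⇒≥ λ ηr<enc → <⇒≱ r<s (minimal r (<⇒≤ ηr<enc , 0<|r|))
      where
      0<|r| : 0 < count r
      0<|r| = let y , y∈ = count-positive 0<enc
                  x , rx = enclosed-occupied y∈
              in ∈⇒count-positive rx
      r<s : count r < count s
      r<s = subst (count r <_) (sym (weight-split _ s T)) (m<n+m _ 0<|s∩T|)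
    bound : weight η (s ∩ T) ≤ count (N G′ T)
    bound with 0 <? weight η (s ∩ T)
    ... | no  ηs∩T≯0 = ≤-trans (≮⇒≥ ηs∩T≯0) z≤n
    ... | yes 0<ηs∩T = +-cancelʳ-≤ (weight η r) _ _ (begin
      weight η (s ∩ T) + weight η r           ≡⟨ weight-split η s T ⟨
      weight η s                              ≤⟨ feasible ⟩
      count (enclosed G s)                    ≤⟨ weight-∪ cover ⟩
      count (N G′ T) + count (enclosed G r)   ≤⟨ +-monoʳ-≤ (count (N G′ T)) (r-deficient 0<|s∩T|) ⟩
      count (N G′ T) + weight η r             ∎)
      where
      0<|s∩T| : 0 < count (s ∩ T)
      0<|s∩T| = let x , x∈ , _ = weight-positive 0<ηs∩T in ∈⇒count-positive x∈

  ClosedStarSubgraph : BipGraph m n → (Fin m → ℕ) → Set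
  ClosedStarSubgraph G η = Σ (Subgraph G) λ H →
    (∃ λ x → Subgraph.VX H x ≡ true) ×
    (∀ x → Subgraph.VX H x ≡ true → degX H x ≡ η x) ×
    (∀ y → Subgraph.VY H y ≡ true → degY H y ≡ 1) ×
    (∀ x y → Subgraph.VY H y ≡ true → G x y ≡ true → Subgraph.VX H x ≡ true)

  matching⇒closedStarSubgraph : ∀ {s} → 0 < count s → Matching (G ↾ʸ enclosed G s) (η ↾ s) →
                                ClosedStarSubgraph G η
  matching⇒closedStarSubgraph {G = G} {η = η} {s = s} 0<|s| M =
    H , count-positive 0<|s| , degX-H , degY-H , closed
    where
    open Matching M
    covered : Fin n → Bool
    covered = N E ⊤
    H : Subgraph G
    H = record
      { VX    = s
      ; VY    = covered
      ; EH    = E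
      ; EH⊆G  = λ x y e → ∧-conicalˡ _ _ (E⊆G x y e)
      ; EH-VX = λ x y e → enclosed-⊆ (∧-conicalʳ _ _ (E⊆G x y e)) (∧-conicalˡ _ _ (E⊆G x y e))
      ; EH-VY = λ x y e → N-intro refl e
      }
    degX-H : ∀ x → s x ≡ true → degX H x ≡ η x
    degX-H x sx = trans (countB≡count (E x)) (trans (degˣ x) (cong (λ b → if b then η x else 0) sx))
    degY-H : ∀ y → covered y ≡ true → degY H y ≡ 1
    degY-H y c = let x , _ , Exy = N-elim c in
      trans (countB≡count _) (≤-antisym (degʸ y) (∈⇒count-positive Exy))
    closed : ∀ x y → covered y ≡ true → G x y ≡ true → s x ≡ true
    closed x y c Gxy = let x′ , _ , Ex′y = N-elim c in
      enclosed-⊆ (∧-conicalʳ _ _ (E⊆G x′ y Ex′y)) Gxy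

lemma4p2 : (m n : ℕ) (G : BipGraph m n) (η : Fin m → ℕ) →
    (∀ x → 1 ≤ η x) →
    Fin m →
    NXsize G ≥ sumOver η →
    Σ (Subgraph G) λ H →
      (∃ λ x → Subgraph.VX H x ≡ true) ×
      (∀ x → Subgraph.VX H x ≡ true → degX H x ≡ η x) ×
      (∀ y → Subgraph.VY H y ≡ true → degY H y ≡ 1) ×
      (∀ x y → Subgraph.VY H y ≡ true → G x y ≡ true → Subgraph.VX H x ≡ true)
lemma4p2 m n G η _ x₀ N≥Ση =
  let s , (feasible , 0<|s|) , minimal =
        least-subset resp dec (⊤-feasible N≥Ση , ∈⇒count-positive {i = x₀} refl)
  in matching⇒closedStarSubgraph 0<|s| (hall (hall-in-minimal feasible minimal))
  where
  resp : (λ S → Feasible G η S × 0 < count S) Respects _≗_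
  resp S≗T (fS , 0<|S|) = feasible-resp S≗T fS , subst (0 <_) (weight-cong S≗T) 0<|S|
  dec : Decidable (λ S → Feasible G η S × 0 < count S)
  dec S = feasible? G η S ×-dec 0 <? count S
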